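{- Let $n\ge 1$. Each of the sets $A_n$, $R_n$ and $S_n$, listed in Reflected Gray Code order $\prec$, is a $3$-adjacent Gray code: any two consecutive sequences in the list differ in at most $3$ positions, and the positions in which they differ form a set of consecutive integers.
   Context: All sequences are finite sequences of non-negative integers. For a sequence $s_1s_2\ldots s_k$ define the statistics $\mathrm{asc}(s_1\ldots s_k)=\#\{i: 1\le i<k,\ s_i<s_{i+1}\}$, $\max(s_1\ldots s_k)=\max\{s_1,\ldots,s_k\}$, and $\mathrm{lv}(s_1\ldots s_k)=s_k$. For a statistic $\mathrm{st}$, a sequence $s_1s_2\ldots s_n$ is an $\mathrm{st}$-restricted growth sequence if $s_1=0$ and $0\le s_{k+1}\le \mathrm{st}(s_1\ldots s_k)+1$ for all $1\le k<n$. $A_n$ (ascent sequences), $R_n$ (restricted growth functions) and $S_n$ (staircase words) are the sets of length-$n$ $\mathrm{st}$-restricted growth sequences for $\mathrm{st}=\mathrm{asc}$, $\max$, $\mathrm{lv}$ respectively. Reflected Gray Code order on length-$n$ sequences: $s\prec t$ if, with $k$ the leftmost position where $s$ and $t$ differ, either $\sum_{i=1}^{k-1}s_i$ is even and $s_k<t_k$, or $\sum_{i=1}^{k-1}s_i$ is odd and $s_k>t_k$. A list of sequences is a $d$-Gray code if the Hamming distance between any two consecutive sequences is at most $d$; it is a $d$-adjacent Gray code if moreover the positions where consecutive sequences differ are adjacent (consecutive). -}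

module Defs where

open import Data.Nat using (ℕ; zero; suc; _+_; _≤_; _<_; _⊔_; _<?_)
open import Data.Sum using (_⊎_)
open import Relation.Nullary using (yes; no)
open import Data.Nat.Properties using ()
open import Data.List using (List; []; _∷_; length; take)
open import Data.Nat.ListAction using (sum)
open import Data.Fin using (Fin; toℕ)
open import Data.Product using (Σ; _×_; _,_; ∃)
open import Data.Nat.Divisibility using (_∣_)
open import Data.Empty using (⊥)
open import Relation.Nullary using (¬_)
open import Relation.Binary.PropositionalEquality using (_≡_)

-- A statistic on (nonempty) finite sequences; on the empty list its value is irrelevant.
Statistic : Set
Statistic = List ℕ → ℕ

ascFrom : ℕ → List ℕ → ℕ
ascFrom x [] = 0
ascFrom x (y ∷ xs) with x <? y
... | yes _ = suc (ascFrom y xs)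
... | no _ = ascFrom y xs

asc : Statistic
asc [] = 0
asc (x ∷ xs) = ascFrom x xs

maxSt : Statistic
maxSt [] = 0
maxSt (x ∷ xs) = x ⊔ maxSt xs

lv : Statistic
lv [] = 0
lv (x ∷ []) = x
lv (x ∷ y ∷ xs) = lv (y ∷ xs)

-- i-th entry (0-based) of a list, default 0 outside range (only used in range)
at : List ℕ → ℕ → ℕ
at [] _ = 0
at (x ∷ xs) zero = x
at (x ∷ xs) (suc i) = at xs i

-- s is an st-restricted growth sequence of length n:
-- s₁ = 0 and s_{k+1} ≤ st(s₁…s_k) + 1 for 1 ≤ k < n  (0-based: at s k ≤ st (take k s) + 1 for 1 ≤ k < n)
IsRGS : Statistic → ℕ → List ℕ → Set
IsRGS st n s = length s ≡ n × (1 ≤ n → at s 0 ≡ 0)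
  × (∀ k → 1 ≤ k → k < n → at s k ≤ st (take k s) + 1)

Ascent Restricted Staircase : ℕ → List ℕ → Set
Ascent = IsRGS asc
Restricted = IsRGS maxSt
Staircase = IsRGS lv

Even : ℕ → Set
Even m = 2 ∣ m

Odd : ℕ → Set
Odd m = ¬ (2 ∣ m)

-- Reflected Gray Code order on sequences of equal length:
-- k (0-based) is the leftmost position where s and t differ.
_≺_ : List ℕ → List ℕ → Set
s ≺ t = Σ ℕ λ k → k < length s × (∀ i → i < k → at s i ≡ at t i) × ¬ (at s k ≡ at t k)
  × ((Even (sum (take k s)) × at s k < at t k) ⊎ (Odd (sum (take k s)) × at t k < at s k))

Consecutive : (List ℕ → Set) → List ℕ → List ℕ → Set
Consecutive P s t = P s × P t × s ≺ t × (∀ u → P u → s ≺ u → u ≺ t → ⊥) 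

DAdjacent : ℕ → List ℕ → List ℕ → Set
DAdjacent d s t = Σ ℕ λ i → Σ ℕ λ j → i ≤ j × j < i + d
  × (∀ k → (¬ (at s k ≡ at t k)) → i ≤ k × k ≤ j)
  × (∀ k → i ≤ k → k ≤ j → ¬ (at s k ≡ at t k))

IsAdjacentGrayCode : ℕ → (List ℕ → Set) → Set
IsAdjacentGrayCode d P = ∀ s t → Consecutive P s t → DAdjacent d s t

-- Let s ≺ t be consecutive and k ≥ 1 their first difference. Consecutiveness forces s_k and t_k to
-- differ by one, and after position k forces s to take its ≺-last and t its ≺-first admissible entry:
-- the maximal entry st + 1 or 0, according to the parity of the prefix sum. Hence the prefix sums up
-- to k + 1 have opposite parities. Once s has an odd and t an even prefix sum, both continue with
-- zeros; once s has an even and t an odd one and their statistics agree, both take the same maximal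
-- entry, and the situation persists. For asc, max and lv the statistic of a prefix depends only on
-- that of the shorter prefix and the last two entries, moves by at most one when the last entry
-- does, and equals a new maximal entry. A parity check at positions k + 1 and k + 2 then shows that
-- one of these synchronised situations is reached by position k + 3, and that position k + 2 can
-- differ only if k + 1 does.

module Submission where

open import Defs
open import Data.Nat
  using (ℕ; zero; suc; _+_; _∸_; _⊔_; _≤_; _<_; _≤′_; ≤′-refl; ≤′-step; z≤n; s≤s; z<s; _<?_; _≟_; parity)
open import Data.Nat.Properties
open import Data.Parity.Base as ℙ using (Parity; 0ℙ; 1ℙ; _⁻¹)
import Data.Parity.Properties as ℙ
open import Data.Product using (∃; _×_; _,_; proj₁; proj₂)
open import Data.Sum using (_⊎_; inj₁; inj₂)
open import Data.List using (List; []; _∷_; length; take; replicate)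
open import Data.List.Properties using (length-replicate)
open import Data.Nat.ListAction using (sum)
open import Data.Empty using (⊥; ⊥-elim)
open import Relation.Nullary using (¬_; Dec; yes; no)
open import Relation.Binary.PropositionalEquality
open import Data.Nat.Divisibility using (divides)
open import Relation.Binary.Definitions using (tri<; tri≈; tri>)

at-≥length : ∀ x i → length x ≤ i → at x i ≡ 0
at-≥length [] i _ = refl
at-≥length (y ∷ ys) (suc i) (s≤s p) = at-≥length ys i p

sum-take-suc : ∀ x i → sum (take (suc i) x) ≡ sum (take i x) + at x i
sum-take-suc [] zero = refl
sum-take-suc [] (suc i) = refl
sum-take-suc (y ∷ ys) zero = +-identityʳ y
sum-take-suc (y ∷ ys) (suc i) =
  trans (cong (y +_) (sum-take-suc ys i)) (sym (+-assoc y (sum (take i ys)) (at ys i)))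

take-cong : ∀ x y k → (∀ i → i < k → at x i ≡ at y i) → k ≤ length x → k ≤ length y →
            take k x ≡ take k y
take-cong x y zero _ _ _ = refl
take-cong (a ∷ x) (b ∷ y) (suc k) eq (s≤s p) (s≤s q) =
  cong₂ _∷_ (eq 0 (s≤s z≤n)) (take-cong x y k (λ i i<k → eq (suc i) (s≤s i<k)) p q)

at-replicate-0 : ∀ m i → at (replicate m 0) i ≡ 0
at-replicate-0 zero i = refl
at-replicate-0 (suc m) zero = refl
at-replicate-0 (suc m) (suc i) = at-replicate-0 m i

resetFrom : List ℕ → ℕ → ℕ → List ℕ
resetFrom [] j v = []
resetFrom (y ∷ ys) zero v = v ∷ replicate (length ys) 0
resetFrom (y ∷ ys) (suc j) v = y ∷ resetFrom ys j v

length-resetFrom : ∀ x j v → length (resetFrom x j v) ≡ length x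
length-resetFrom [] j v = refl
length-resetFrom (y ∷ ys) zero v = cong suc (length-replicate (length ys))
length-resetFrom (y ∷ ys) (suc j) v = cong suc (length-resetFrom ys j v)

at-resetFrom-< : ∀ x j v i → i < j → at (resetFrom x j v) i ≡ at x i
at-resetFrom-< [] j v i _ = refl
at-resetFrom-< (y ∷ ys) (suc j) v zero _ = refl
at-resetFrom-< (y ∷ ys) (suc j) v (suc i) (s≤s p) = at-resetFrom-< ys j v i p

at-resetFrom-≡ : ∀ x j v → j < length x → at (resetFrom x j v) j ≡ v
at-resetFrom-≡ (y ∷ ys) zero v _ = refl
at-resetFrom-≡ (y ∷ ys) (suc j) v (s≤s p) = at-resetFrom-≡ ys j v p

at-resetFrom-> : ∀ x j v i → j < i → at (resetFrom x j v) i ≡ 0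
at-resetFrom-> [] j v i _ = refl
at-resetFrom-> (y ∷ ys) zero v (suc i) _ = at-replicate-0 (length ys) i
at-resetFrom-> (y ∷ ys) (suc j) v (suc i) (s≤s p) = at-resetFrom-> ys j v i p

take-resetFrom : ∀ x j v i → i ≤ j → take i (resetFrom x j v) ≡ take i x
take-resetFrom x j v zero _ = refl
take-resetFrom [] j v (suc i) _ = refl
take-resetFrom (y ∷ ys) (suc j) v (suc i) (s≤s p) = cong (y ∷_) (take-resetFrom ys j v i p)

resetFrom-valid : ∀ {st n} x j v → IsRGS st n x → 1 ≤ j → j < n → v ≤ st (take j x) + 1 →
                  IsRGS st n (resetFrom x j v)
resetFrom-valid {st} {n} x j v (len , head , growth) 1≤j j<n v≤ =
  trans (length-resetFrom x j v) len , (λ 1≤n → trans (at-resetFrom-< x j v 0 1≤j) (head 1≤n)) , growth′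
  where
  growth′ : ∀ i → 1 ≤ i → i < n → at (resetFrom x j v) i ≤ st (take i (resetFrom x j v)) + 1
  growth′ i 1≤i i<n with <-cmp i j
  ... | tri< i<j _ _ = subst₂ _≤_ (sym (at-resetFrom-< x j v i i<j))
                         (cong (λ z → st z + 1) (sym (take-resetFrom x j v i (<⇒≤ i<j)))) (growth i 1≤i i<n)
  ... | tri≈ _ refl _ = subst₂ _≤_ (sym (at-resetFrom-≡ x i v (subst (i <_) (sym len) i<n)))
                          (cong (λ z → st z + 1) (sym (take-resetFrom x i v i ≤-refl))) v≤
  ... | tri> _ _ j<i = subst (_≤ st (take i (resetFrom x j v)) + 1) (sym (at-resetFrom-> x j v i j<i)) z≤n

parity-suc : ∀ m → parity (suc m) ≡ parity m ⁻¹
parity-suc m = sym (ℙ.⁻¹-selfInverse (ℙ.suc-homo-⁻¹ m))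

even⇒parity≡0ℙ : ∀ {m} → Even m → parity m ≡ 0ℙ
even⇒parity≡0ℙ (divides q refl) = trans (ℙ.*-homo-* q 2) (ℙ.*-zeroʳ (parity q))

parity≡0ℙ⇒even : ∀ m → parity m ≡ 0ℙ → Even m
parity≡0ℙ⇒even zero _ = divides 0 refl
parity≡0ℙ⇒even (suc (suc m)) p with parity≡0ℙ⇒even m p
... | divides q eq = divides (suc q) (cong (λ z → suc (suc z)) eq)

parity≡1ℙ⇒odd : ∀ m → parity m ≡ 1ℙ → Odd m
parity≡1ℙ⇒odd m p ev with trans (sym p) (even⇒parity≡0ℙ ev)
... | ()

prefixParity : List ℕ → ℕ → Parity
prefixParity x j = parity (sum (take j x))

prefixParity-suc : ∀ x j → prefixParity x (suc j) ≡ prefixParity x j ℙ.+ parity (at x j)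
prefixParity-suc x j = trans (cong parity (sum-take-suc x j)) (ℙ.+-homo-+ (sum (take j x)) (at x j))

prefixParity-cong : ∀ x y k → (∀ i → i < k → at x i ≡ at y i) → k ≤ length x → k ≤ length y →
                    prefixParity x k ≡ prefixParity y k
prefixParity-cong x y k eq k≤x k≤y = cong (λ z → parity (sum z)) (take-cong x y k eq k≤x k≤y)

-- Reflected Gray code: after an even prefix sum larger entries come later, after an odd one smaller.
_<[_]_ : ℕ → Parity → ℕ → Set
a <[ 0ℙ ] b = a < b
a <[ 1ℙ ] b = b < a

<[]⇒≢ : ∀ {a b} p → a <[ p ] b → a ≢ b
<[]⇒≢ 0ℙ a<b = <⇒≢ a<b
<[]⇒≢ 1ℙ b<a = ≢-sym (<⇒≢ b<a)

record _≺⟨_⟩_ (s : List ℕ) (k : ℕ) (t : List ℕ) : Set where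
  constructor mk≺
  field
    k<length : k < length s
    agree-below : ∀ i → i < k → at s i ≡ at t i
    differs-at : at s k <[ prefixParity s k ] at t k

≺⟨⟩⇒≺ : ∀ {s t} k → s ≺⟨ k ⟩ t → s ≺ t
≺⟨⟩⇒≺ {s} {t} k (mk≺ k<len agree differs) =
  k , k<len , agree , <[]⇒≢ (prefixParity s k) differs , direction (prefixParity s k) refl differs
  where
  σ = sum (take k s)
  direction : ∀ p → parity σ ≡ p → at s k <[ p ] at t k →
              (Even σ × at s k < at t k) ⊎ (Odd σ × at t k < at s k)
  direction 0ℙ eq a<b = inj₁ (parity≡0ℙ⇒even σ eq , a<b)
  direction 1ℙ eq b<a = inj₂ (parity≡1ℙ⇒odd σ eq , b<a)

≺⇒≺⟨⟩ : ∀ {s t} → s ≺ t → ∃ λ k → s ≺⟨ k ⟩ t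
≺⇒≺⟨⟩ {s} (k , k<len , agree , _ , inj₁ (even , a<b)) =
  k , mk≺ k<len agree (subst (λ p → at s k <[ p ] _) (sym (even⇒parity≡0ℙ even)) a<b)
≺⇒≺⟨⟩ {s} (k , k<len , agree , _ , inj₂ (odd , b<a)) with prefixParity s k in eq
... | 1ℙ = k , mk≺ k<len agree (subst (λ p → at s k <[ p ] _) (sym eq) b<a)
... | 0ℙ = ⊥-elim (odd (parity≡0ℙ⇒even _ eq))

≺⟨⟩-changeˡ : ∀ {s t u k} → s ≺⟨ k ⟩ t → length u ≡ length s → (∀ i → i < k → at u i ≡ at s i) →
              at u k <[ prefixParity s k ] at t k → u ≺⟨ k ⟩ t
≺⟨⟩-changeˡ {s} {t} {u} {k} (mk≺ k<len agree _) len eq differs =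
  mk≺ k<len′ (λ i i<k → trans (eq i i<k) (agree i i<k))
      (subst (λ p → at u k <[ p ] at t k) (sym same-parity) differs)
  where
  k<len′ = subst (k <_) (sym len) k<len
  same-parity = prefixParity-cong u s k eq (<⇒≤ k<len′) (<⇒≤ k<len)

≺⟨⟩-changeʳ : ∀ {s t u k} → s ≺⟨ k ⟩ t → (∀ i → i < k → at u i ≡ at t i) →
              at s k <[ prefixParity s k ] at u k → s ≺⟨ k ⟩ u
≺⟨⟩-changeʳ (mk≺ k<len agree _) eq differs =
  mk≺ k<len (λ i i<k → trans (agree i i<k) (sym (eq i i<k))) differs

≺⟨⟩-resetFrom : ∀ {x j v} → j < length x → at x j <[ prefixParity x j ] v → x ≺⟨ j ⟩ resetFrom x j v
≺⟨⟩-resetFrom {x} {j} {v} j<len differs =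
  mk≺ j<len (λ i i<j → sym (at-resetFrom-< x j v i i<j))
      (subst (at x j <[ prefixParity x j ]_) (sym (at-resetFrom-≡ x j v j<len)) differs)

resetFrom-≺⟨⟩ : ∀ {x j v} → j < length x → v <[ prefixParity x j ] at x j → resetFrom x j v ≺⟨ j ⟩ x
resetFrom-≺⟨⟩ {x} {j} {v} j<len differs =
  mk≺ (subst (j <_) (sym (length-resetFrom x j v)) j<len) (at-resetFrom-< x j v)
      (subst₂ (λ p a → a <[ p ] at x j) (sym (cong (λ z → parity (sum z)) (take-resetFrom x j v j ≤-refl)))
              (sym (at-resetFrom-≡ x j v j<len)) differs)

-- The ≺-last entry of 0 … b after a prefix sum of parity p; lastIn (p ⁻¹) b is the ≺-first.
lastIn : Parity → ℕ → ℕ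
lastIn 0ℙ b = b
lastIn 1ℙ b = 0

lastIn-≤ : ∀ p b → lastIn p b ≤ b
lastIn-≤ 0ℙ b = ≤-refl
lastIn-≤ 1ℙ b = z≤n

<[]-lastIn : ∀ p {a b} → a ≤ b → a ≢ lastIn p b → a <[ p ] lastIn p b
<[]-lastIn 0ℙ a≤b a≢b = ≤∧≢⇒< a≤b a≢b
<[]-lastIn 1ℙ _ a≢0 = n≢0⇒n>0 a≢0

lastIn⁻¹-<[] : ∀ p {a b} → a ≤ b → a ≢ lastIn (p ⁻¹) b → lastIn (p ⁻¹) b <[ p ] a
lastIn⁻¹-<[] 0ℙ _ a≢0 = n≢0⇒n>0 a≢0
lastIn⁻¹-<[] 1ℙ a≤b a≢b = ≤∧≢⇒< a≤b a≢b

Adjacent : ℕ → ℕ → Set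
Adjacent a b = b ≡ suc a ⊎ a ≡ suc b

<[]-between : ∀ p {a b} → a <[ p ] b → ¬ Adjacent a b → ∃ λ c → a <[ p ] c × c <[ p ] b × c ≤ a ⊔ b
<[]-between 0ℙ {a} {b} a<b ¬adj =
  suc a , ≤-refl , ≤∧≢⇒< a<b (λ eq → ¬adj (inj₁ (sym eq))) , ≤-trans a<b (m≤n⊔m a b)
<[]-between 1ℙ {a} {b} b<a ¬adj =
  suc b , ≤∧≢⇒< b<a (λ eq → ¬adj (inj₂ (sym eq))) , ≤-refl , ≤-trans b<a (m≤m⊔n a b)

record ConsecutiveShape (st : Statistic) (n : ℕ) (s t : List ℕ) : Set where
  field
    k : ℕ
    1≤k : 1 ≤ k
    k<n : k < n
    agree-below : ∀ i → i < k → at s i ≡ at t i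
    adjacent-at : Adjacent (at s k) (at t k)
    s-last-after : ∀ j → k < j → j < n → at s j ≡ lastIn (prefixParity s j) (st (take j s) + 1)
    t-first-after : ∀ j → k < j → j < n → at t j ≡ lastIn (prefixParity t j ⁻¹) (st (take j t) + 1)

module ConsecutivePair {st : Statistic} {n : ℕ} {s t : List ℕ} (1≤n : 1 ≤ n)
  (s-valid : IsRGS st n s) (t-valid : IsRGS st n t) {k : ℕ} (s≺t : s ≺⟨ k ⟩ t)
  (nothing-between : ∀ u → IsRGS st n u → s ≺ u → u ≺ t → ⊥) where

  open _≺⟨_⟩_ s≺t

  between : ∀ u {i j} → IsRGS st n u → s ≺⟨ i ⟩ u → u ≺⟨ j ⟩ t → ⊥
  between _ u-valid s≺u u≺t = nothing-between _ u-valid (≺⟨⟩⇒≺ _ s≺u) (≺⟨⟩⇒≺ _ u≺t)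

  growth-s : ∀ i → 1 ≤ i → i < n → at s i ≤ st (take i s) + 1
  growth-s = proj₂ (proj₂ s-valid)

  growth-t : ∀ i → 1 ≤ i → i < n → at t i ≤ st (take i t) + 1
  growth-t = proj₂ (proj₂ t-valid)

  k<n : k < n
  k<n = subst (k <_) (proj₁ s-valid) k<length

  1≤k : 1 ≤ k
  1≤k = positive k (<[]⇒≢ (prefixParity s k) differs-at)
    where
    positive : ∀ m → at s m ≢ at t m → 1 ≤ m
    positive zero ne = ⊥-elim (ne (trans (proj₁ (proj₂ s-valid) 1≤n) (sym (proj₁ (proj₂ t-valid) 1≤n))))
    positive (suc _) _ = s≤s z≤n

  bound-at-k : at s k ⊔ at t k ≤ st (take k s) + 1
  bound-at-k = ⊔-lub (growth-s k 1≤k k<n) (subst (λ z → at t k ≤ st z + 1) same-prefix (growth-t k 1≤k k<n))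
    where
    same-prefix : take k t ≡ take k s
    same-prefix = take-cong t s k (λ i i<k → sym (agree-below i i<k))
                    (subst (k ≤_) (sym (proj₁ t-valid)) (<⇒≤ k<n)) (<⇒≤ k<length)

  adjacent-at : Adjacent (at s k) (at t k)
  adjacent-at with at t k ≟ suc (at s k) | at s k ≟ suc (at t k)
  ... | yes up | _ = inj₁ up
  ... | no _ | yes down = inj₂ down
  ... | no ¬up | no ¬down =
    ⊥-elim (squeeze (<[]-between p differs-at λ { (inj₁ up) → ¬up up ; (inj₂ down) → ¬down down }))
    where
    p = prefixParity s k
    squeeze : (∃ λ c → at s k <[ p ] c × c <[ p ] at t k × c ≤ at s k ⊔ at t k) → ⊥
    squeeze (c , s<c , c<t , c≤) =
      between (resetFrom s k c) (resetFrom-valid {st} s k c s-valid 1≤k k<n (≤-trans c≤ bound-at-k))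
        (≺⟨⟩-resetFrom k<length s<c)
        (≺⟨⟩-changeˡ s≺t (length-resetFrom s k c) (at-resetFrom-< s k c)
          (subst (_<[ p ] at t k) (sym (at-resetFrom-≡ s k c k<length)) c<t))

  s-last-after : ∀ j → k < j → j < n → at s j ≡ lastIn (prefixParity s j) (st (take j s) + 1)
  s-last-after j k<j j<n with at s j ≟ lastIn (prefixParity s j) (st (take j s) + 1)
  ... | yes eq = eq
  ... | no ne = ⊥-elim (between u u-valid s≺u u≺t)
    where
    v = lastIn (prefixParity s j) (st (take j s) + 1)
    u = resetFrom s j v
    1≤j = ≤-trans 1≤k (<⇒≤ k<j)
    u-valid : IsRGS st n u
    u-valid = resetFrom-valid {st} s j v s-valid 1≤j j<n (lastIn-≤ _ _)
    s≺u : s ≺⟨ j ⟩ u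
    s≺u = ≺⟨⟩-resetFrom (subst (j <_) (sym (proj₁ s-valid)) j<n)
            (<[]-lastIn (prefixParity s j) (growth-s j 1≤j j<n) ne)
    u≺t : u ≺⟨ k ⟩ t
    u≺t = ≺⟨⟩-changeˡ s≺t (length-resetFrom s j v) (λ i i<k → at-resetFrom-< s j v i (<-trans i<k k<j))
            (subst (_<[ prefixParity s k ] at t k) (sym (at-resetFrom-< s j v k k<j)) differs-at)

  t-first-after : ∀ j → k < j → j < n → at t j ≡ lastIn (prefixParity t j ⁻¹) (st (take j t) + 1)
  t-first-after j k<j j<n with at t j ≟ lastIn (prefixParity t j ⁻¹) (st (take j t) + 1)
  ... | yes eq = eq
  ... | no ne = ⊥-elim (between u u-valid s≺u u≺t)
    where
    v = lastIn (prefixParity t j ⁻¹) (st (take j t) + 1)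
    u = resetFrom t j v
    1≤j = ≤-trans 1≤k (<⇒≤ k<j)
    u-valid : IsRGS st n u
    u-valid = resetFrom-valid {st} t j v t-valid 1≤j j<n (lastIn-≤ _ _)
    s≺u : s ≺⟨ k ⟩ u
    s≺u = ≺⟨⟩-changeʳ s≺t (λ i i<k → at-resetFrom-< t j v i (<-trans i<k k<j))
            (subst (at s k <[ prefixParity s k ]_) (sym (at-resetFrom-< t j v k k<j)) differs-at)
    u≺t : u ≺⟨ j ⟩ t
    u≺t = resetFrom-≺⟨⟩ (subst (j <_) (sym (proj₁ t-valid)) j<n)
            (lastIn⁻¹-<[] (prefixParity t j) (growth-t j 1≤j j<n) ne)

  shape : ConsecutiveShape st n s t
  shape = record
    { k = k ; 1≤k = 1≤k ; k<n = k<n ; agree-below = agree-below ; adjacent-at = adjacent-at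
    ; s-last-after = s-last-after ; t-first-after = t-first-after }

consecutive⇒shape : ∀ {st n s t} → 1 ≤ n → Consecutive (IsRGS st n) s t → ConsecutiveShape st n s t
consecutive⇒shape 1≤n (s-valid , t-valid , s≺t , nothing-between) =
  ConsecutivePair.shape 1≤n s-valid t-valid (proj₂ (≺⇒≺⟨⟩ s≺t)) nothing-between

p+q⁻¹≡[p+q]⁻¹ : ∀ p q → p ℙ.+ q ⁻¹ ≡ (p ℙ.+ q) ⁻¹
p+q⁻¹≡[p+q]⁻¹ 0ℙ q = refl
p+q⁻¹≡[p+q]⁻¹ 1ℙ q = refl

parity-+1 : ∀ m → parity (m + 1) ≡ parity m ⁻¹
parity-+1 m = trans (ℙ.+-homo-+ m 1) (ℙ.+-comm (parity m) 1ℙ)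

parity-adjacent : ∀ {a b} → Adjacent a b → parity b ≡ parity a ⁻¹
parity-adjacent {a} (inj₁ refl) = parity-suc a
parity-adjacent {b = b} (inj₂ refl) = sym (trans (cong _⁻¹ (parity-suc b)) (ℙ.⁻¹-involutive (parity b)))

same-parity-neighbours : ∀ {a b} → a ≤ suc b → b ≤ suc a → parity a ≡ parity b → a ≡ b
same-parity-neighbours {a} {b} a≤1+b b≤1+a same with <-cmp a b
... | tri≈ _ a≡b _ = a≡b
... | tri< a<b _ _ = ⊥-elim (ℙ.p≢p⁻¹ (parity a)
                       (trans same (parity-adjacent (inj₁ (sym (≤-antisym a<b b≤1+a))))))
... | tri> _ _ b<a = ⊥-elim (ℙ.p≢p⁻¹ (parity b)
                       (trans (sym same) (parity-adjacent (inj₁ (sym (≤-antisym b<a a≤1+b))))))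

prefixParity-step : ∀ x j {p q} → prefixParity x j ≡ p → parity (at x j) ≡ q →
                    prefixParity x (suc j) ≡ p ℙ.+ q
prefixParity-step x j refl refl = prefixParity-suc x j

record LocalRecurrence (st : Statistic) (n : ℕ) : Set where
  field
    next : ℕ → ℕ → ℕ → ℕ
    st-take-suc : ∀ x i → 1 ≤ i → i < length x →
                  st (take (suc i) x) ≡ next (st (take i x)) (at x (i ∸ 1)) (at x i)
    next-suc : ∀ a l c → next a l c ≤ suc (next a l (suc c)) × next a l (suc c) ≤ suc (next a l c)
    st-take-suc-new-max : ∀ x j → IsRGS st n x → 1 ≤ j → j < n → at x j ≡ st (take j x) + 1 →
                          st (take (suc j) x) ≡ at x j

  next-adjacent : ∀ a l {c c′} → Adjacent c c′ →
                  next a l c ≤ suc (next a l c′) × next a l c′ ≤ suc (next a l c)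
  next-adjacent a l {c} (inj₁ refl) = next-suc a l c
  next-adjacent a l {c′ = c′} (inj₂ refl) = proj₂ (next-suc a l c′) , proj₁ (next-suc a l c′)

DiffersExactlyOn : List ℕ → List ℕ → ℕ → ℕ → Set
DiffersExactlyOn s t i j =
  (∀ m → at s m ≢ at t m → i ≤ m × m ≤ j) × (∀ m → i ≤ m → m ≤ j → at s m ≢ at t m)

differsExactlyOn-or-one-more : ∀ {s t} i j → (∀ m → m < i → at s m ≡ at t m) →
  (∀ m → i ≤ m → m ≤ j → at s m ≢ at t m) → (∀ m → 2 + j ≤ m → at s m ≡ at t m) →
  DiffersExactlyOn s t i j ⊎ DiffersExactlyOn s t i (suc j)
differsExactlyOn-or-one-more {s} {t} i j below inside above = extend (at s (suc j) ≟ at t (suc j))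
  where
  located : ∀ m → at s m ≢ at t m → i ≤ m × m ≤ suc j
  located m ne with m <? i | m ≤? suc j
  ... | yes m<i | _ = ⊥-elim (ne (below m m<i))
  ... | no m≮i | yes m≤1+j = ≮⇒≥ m≮i , m≤1+j
  ... | no _ | no m≰1+j = ⊥-elim (ne (above m (≰⇒> m≰1+j)))

  extend : Dec (at s (suc j) ≡ at t (suc j)) → DiffersExactlyOn s t i j ⊎ DiffersExactlyOn s t i (suc j)
  extend (yes eq) = inj₁ (located′ , inside)
    where
    located′ : ∀ m → at s m ≢ at t m → i ≤ m × m ≤ j
    located′ m ne with located m ne
    ... | i≤m , m≤1+j with m≤n⇒m<n∨m≡n m≤1+j
    ...   | inj₁ (s≤s m≤j) = i≤m , m≤j
    ...   | inj₂ refl = ⊥-elim (ne eq)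
  extend (no ne) = inj₂ (located , inside′)
    where
    inside′ : ∀ m → i ≤ m → m ≤ suc j → at s m ≢ at t m
    inside′ m i≤m m≤1+j with m≤n⇒m<n∨m≡n m≤1+j
    ... | inj₁ (s≤s m≤j) = inside m i≤m m≤j
    ... | inj₂ refl = ne

module AfterFirstDifference {st : Statistic} {n : ℕ} (R : LocalRecurrence st n) {s t : List ℕ}
  (s-valid : IsRGS st n s) (t-valid : IsRGS st n t) (shape : ConsecutiveShape st n s t) where

  open LocalRecurrence R
  open ConsecutiveShape shape

  <n⇒<length-s : ∀ {i} → i < n → i < length s
  <n⇒<length-s = subst (_ <_) (sym (proj₁ s-valid))

  <n⇒<length-t : ∀ {i} → i < n → i < length t
  <n⇒<length-t = subst (_ <_) (sym (proj₁ t-valid))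

  agree-beyond : ∀ i → n ≤ i → at s i ≡ at t i
  agree-beyond i n≤i = trans (at-≥length s i (subst (_≤ i) (sym (proj₁ s-valid)) n≤i))
                             (sym (at-≥length t i (subst (_≤ i) (sym (proj₁ t-valid)) n≤i)))

  s-at : ∀ {i p} → k < i → i < n → prefixParity s i ≡ p → at s i ≡ lastIn p (st (take i s) + 1)
  s-at k<i i<n refl = s-last-after _ k<i i<n

  t-at : ∀ {i p} → k < i → i < n → prefixParity t i ≡ p → at t i ≡ lastIn (p ⁻¹) (st (take i t) + 1)
  t-at k<i i<n refl = t-first-after _ k<i i<n

  data Synced (i : ℕ) : Set where
    zeros : prefixParity s i ≡ 1ℙ → prefixParity t i ≡ 0ℙ → Synced i
    maxima : prefixParity s i ≡ 0ℙ → prefixParity t i ≡ 1ℙ → st (take i s) ≡ st (take i t) →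
             at s (i ∸ 1) ≡ at t (i ∸ 1) → Synced i

  synced-eq : ∀ {i} → k < i → i < n → Synced i → at s i ≡ at t i
  synced-eq k<i i<n (zeros ps pt) = trans (s-at k<i i<n ps) (sym (t-at k<i i<n pt))
  synced-eq k<i i<n (maxima ps pt same _) =
    trans (s-at k<i i<n ps) (trans (cong (_+ 1) same) (sym (t-at k<i i<n pt)))

  synced-suc : ∀ {i} → k < i → i < n → Synced i → Synced (suc i)
  synced-suc {i} k<i i<n (zeros ps pt) =
    zeros (prefixParity-step s i ps (cong parity (s-at k<i i<n ps)))
          (prefixParity-step t i pt (cong parity (t-at k<i i<n pt)))
  synced-suc {i} k<i i<n sync@(maxima ps pt same previous) with parity (at s i) in pv
  ... | 1ℙ = zeros (prefixParity-step s i ps pv) (prefixParity-step t i pt (trans (cong parity (sym equal)) pv))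
    where equal = synced-eq k<i i<n sync
  ... | 0ℙ = maxima (prefixParity-step s i ps pv) (prefixParity-step t i pt (trans (cong parity (sym equal)) pv))
                    stats-equal equal
    where
    equal = synced-eq k<i i<n sync
    1≤i = ≤-trans 1≤k (<⇒≤ k<i)
    stats-equal : st (take (suc i) s) ≡ st (take (suc i) t)
    stats-equal = begin
      st (take (suc i) s)                                 ≡⟨ st-take-suc s i 1≤i (<n⇒<length-s i<n) ⟩
      next (st (take i s)) (at s (i ∸ 1)) (at s i)        ≡⟨ cong₂ (λ a l → next a l (at s i)) same previous ⟩
      next (st (take i t)) (at t (i ∸ 1)) (at s i)        ≡⟨ cong (next _ _) equal ⟩
      next (st (take i t)) (at t (i ∸ 1)) (at t i)        ≡⟨ st-take-suc t i 1≤i (<n⇒<length-t i<n) ⟨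
      st (take (suc i) t)                                 ∎
      where open ≡-Reasoning

  synced-≤′ : ∀ {i m} → k < i → i ≤′ m → m < n → Synced i → Synced m
  synced-≤′ _ ≤′-refl _ sync = sync
  synced-≤′ k<i (≤′-step i≤′m) m+1<n sync =
    synced-suc (<-≤-trans k<i (≤′⇒≤ i≤′m)) (<-trans (n<1+n _) m+1<n)
               (synced-≤′ k<i i≤′m (<-trans (n<1+n _) m+1<n) sync)

  synced⇒agree-from : ∀ {i} → k < i → Synced i → ∀ m → i ≤ m → at s m ≡ at t m
  synced⇒agree-from k<i sync m i≤m with m <? n
  ... | yes m<n = synced-eq (<-≤-trans k<i i≤m) m<n (synced-≤′ k<i (≤⇒≤′ i≤m) m<n sync)
  ... | no m≮n = agree-beyond m (≮⇒≥ m≮n)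

  differs-at-k : at s k ≢ at t k
  differs-at-k eq with adjacent-at
  ... | inj₁ up = 1+n≢n (trans (sym up) (sym eq))
  ... | inj₂ down = 1+n≢n (trans (sym down) eq)

  same-prefix : take k s ≡ take k t
  same-prefix = take-cong s t k agree-below (<⇒≤ (<n⇒<length-s k<n)) (<⇒≤ (<n⇒<length-t k<n))

  opposite-after-k : prefixParity t (suc k) ≡ prefixParity s (suc k) ⁻¹
  opposite-after-k = begin
    prefixParity t (suc k)                      ≡⟨ prefixParity-suc t k ⟩
    prefixParity t k ℙ.+ parity (at t k)        ≡⟨ cong₂ ℙ._+_ (cong (λ z → parity (sum z)) (sym same-prefix))
                                                                (parity-adjacent adjacent-at) ⟩
    prefixParity s k ℙ.+ parity (at s k) ⁻¹     ≡⟨ p+q⁻¹≡[p+q]⁻¹ (prefixParity s k) (parity (at s k)) ⟩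
    (prefixParity s k ℙ.+ parity (at s k)) ⁻¹   ≡⟨ cong _⁻¹ (prefixParity-suc s k) ⟨
    prefixParity s (suc k) ⁻¹                   ∎
    where open ≡-Reasoning

  stats-adjacent : st (take (suc k) s) ≤ suc (st (take (suc k) t)) ×
                   st (take (suc k) t) ≤ suc (st (take (suc k) s))
  stats-adjacent
    rewrite st-take-suc s k 1≤k (<n⇒<length-s k<n) | st-take-suc t k 1≤k (<n⇒<length-t k<n)
          | same-prefix | agree-below (k ∸ 1) (∸-monoʳ-< z<s 1≤k) = next-adjacent _ _ adjacent-at

  k<2+k : k < 2 + k
  k<2+k = s≤s (n≤1+n k)

  k<3+k : k < 3 + k
  k<3+k = <-trans k<2+k (n<1+n _)

  data Tail : Set where
    agree-from-2+k : (∀ m → 2 + k ≤ m → at s m ≡ at t m) → Tail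
    differ-at-1+k : at s (suc k) ≢ at t (suc k) → (∀ m → 3 + k ≤ m → at s m ≡ at t m) → Tail

  module SecondEntry (ps : prefixParity s (suc k) ≡ 0ℙ) (k+1<n : suc k < n) where

    pt : prefixParity t (suc k) ≡ 1ℙ
    pt = trans opposite-after-k (cong _⁻¹ ps)

    s-max : at s (suc k) ≡ st (take (suc k) s) + 1
    s-max = s-at ≤-refl k+1<n ps

    t-max : at t (suc k) ≡ st (take (suc k) t) + 1
    t-max = t-at ≤-refl k+1<n pt

    s-stat : st (take (2 + k) s) ≡ at s (suc k)
    s-stat = st-take-suc-new-max s (suc k) s-valid (s≤s z≤n) k+1<n s-max

    t-stat : st (take (2 + k) t) ≡ at t (suc k)
    t-stat = st-take-suc-new-max t (suc k) t-valid (s≤s z≤n) k+1<n t-max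

    same-parity⇒equal : parity (at s (suc k)) ≡ parity (at t (suc k)) → at s (suc k) ≡ at t (suc k)
    same-parity⇒equal same = trans s-max (trans (cong (_+ 1) stats-equal) (sym t-max))
      where
      σ = st (take (suc k) s)
      τ = st (take (suc k) t)
      parities : parity σ ⁻¹ ≡ parity τ ⁻¹
      parities = begin
        parity σ ⁻¹            ≡⟨ parity-+1 σ ⟨
        parity (σ + 1)         ≡⟨ cong parity s-max ⟨
        parity (at s (suc k))  ≡⟨ same ⟩
        parity (at t (suc k))  ≡⟨ cong parity t-max ⟩
        parity (τ + 1)         ≡⟨ parity-+1 τ ⟩
        parity τ ⁻¹            ∎
        where open ≡-Reasoning
      stats-equal : σ ≡ τ
      stats-equal = same-parity-neighbours (proj₁ stats-adjacent) (proj₂ stats-adjacent) (ℙ.⁻¹-injective parities)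

    odd-after-even-max : ∀ x → parity (at x (suc k)) ≡ 0ℙ → st (take (2 + k) x) ≡ at x (suc k) →
                         parity (st (take (2 + k) x) + 1) ≡ 1ℙ
    odd-after-even-max x even stat =
      trans (parity-+1 (st (take (2 + k) x))) (cong _⁻¹ (trans (cong parity stat) even))

    agree-from-3+k : (2 + k < n → Synced (3 + k)) → ∀ m → 3 + k ≤ m → at s m ≡ at t m
    agree-from-3+k synced with 2 + k <? n
    ... | yes k+2<n = synced⇒agree-from k<3+k (synced k+2<n)
    ... | no k+2≮n = λ m k+3≤m → agree-beyond m (≤-trans (≮⇒≥ k+2≮n) (≤-trans (n≤1+n _) k+3≤m))

    tail : Tail
    tail with parity (at s (suc k)) in pa | parity (at t (suc k)) in pb
    ... | 1ℙ | 1ℙ = agree-from-2+k (synced⇒agree-from k<2+k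
                      (zeros (prefixParity-step s (suc k) ps pa) (prefixParity-step t (suc k) pt pb)))
    ... | 0ℙ | 0ℙ = agree-from-2+k (synced⇒agree-from k<2+k
                      (maxima (prefixParity-step s (suc k) ps pa) (prefixParity-step t (suc k) pt pb)
                              (trans s-stat (trans equal (sym t-stat))) equal))
      where equal = same-parity⇒equal (trans pa (sym pb))
    ... | 1ℙ | 0ℙ = differ-at-1+k (λ eq → ℙ.p≢p⁻¹ 1ℙ (trans (sym pa) (trans (cong parity eq) pb)))
                      (agree-from-3+k λ k+2<n →
                        zeros (prefixParity-step s (2 + k) ps₂ (cong parity (s-at k<2+k k+2<n ps₂)))
                              (prefixParity-step t (2 + k) pt₂
                                (trans (cong parity (t-at k<2+k k+2<n pt₂)) (odd-after-even-max t pb t-stat))))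
      where
      ps₂ = prefixParity-step s (suc k) ps pa
      pt₂ = prefixParity-step t (suc k) pt pb
    ... | 0ℙ | 1ℙ = differ-at-1+k (λ eq → ℙ.p≢p⁻¹ 0ℙ (trans (sym pa) (trans (cong parity eq) pb)))
                      (agree-from-3+k λ k+2<n →
                        zeros (prefixParity-step s (2 + k) ps₂
                                (trans (cong parity (s-at k<2+k k+2<n ps₂)) (odd-after-even-max s pa s-stat)))
                              (prefixParity-step t (2 + k) pt₂ (cong parity (t-at k<2+k k+2<n pt₂))))
      where
      ps₂ = prefixParity-step s (suc k) ps pa
      pt₂ = prefixParity-step t (suc k) pt pb

  tail : Tail
  tail with prefixParity s (suc k) in ps
  ... | 1ℙ = agree-from-2+k λ m k+2≤m →
               synced⇒agree-from ≤-refl (zeros ps (trans opposite-after-k (cong _⁻¹ ps))) m (<⇒≤ k+2≤m)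
  ... | 0ℙ with suc k <? n
  ...   | yes k+1<n = SecondEntry.tail ps k+1<n
  ...   | no k+1≮n = agree-from-2+k λ m k+2≤m → agree-beyond m (≤-trans (≮⇒≥ k+1≮n) (<⇒≤ k+2≤m))

  differs-only-at-k : ∀ m → k ≤ m → m ≤ k → at s m ≢ at t m
  differs-only-at-k m k≤m m≤k rewrite ≤-antisym m≤k k≤m = differs-at-k

  exactly⇒3-adjacent : ∀ {j} → j ≤ 2 + k → DiffersExactlyOn s t k j → DAdjacent 3 s t
  exactly⇒3-adjacent {j} j≤2+k exact@(located , _) =
    k , j , proj₂ (located k differs-at-k) , subst (j <_) (+-comm 3 k) (s≤s j≤2+k) , exact

  either⇒3-adjacent : ∀ j → suc j ≤ 2 + k → DiffersExactlyOn s t k j ⊎ DiffersExactlyOn s t k (suc j) →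
                      DAdjacent 3 s t
  either⇒3-adjacent j 1+j≤2+k (inj₁ exact) = exactly⇒3-adjacent (≤-trans (n≤1+n j) 1+j≤2+k) exact
  either⇒3-adjacent j 1+j≤2+k (inj₂ exact) = exactly⇒3-adjacent 1+j≤2+k exact

  3-adjacent : DAdjacent 3 s t
  3-adjacent with tail
  ... | agree-from-2+k agree =
    either⇒3-adjacent k (n≤1+n _)
      (differsExactlyOn-or-one-more {s} {t} k k agree-below differs-only-at-k agree)
  ... | differ-at-1+k differs agree =
    either⇒3-adjacent (suc k) ≤-refl
      (differsExactlyOn-or-one-more {s} {t} k (suc k) agree-below differs-on-k,1+k agree)
    where
    differs-on-k,1+k : ∀ m → k ≤ m → m ≤ suc k → at s m ≢ at t m
    differs-on-k,1+k m k≤m m≤1+k with m≤n⇒m<n∨m≡n m≤1+k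
    ... | inj₁ (s≤s m≤k) = differs-only-at-k m k≤m m≤k
    ... | inj₂ refl = differs

shape⇒3-adjacent : ∀ {st n s t} → LocalRecurrence st n → IsRGS st n s → IsRGS st n t →
                   ConsecutiveShape st n s t → DAdjacent 3 s t
shape⇒3-adjacent R = AfterFirstDifference.3-adjacent R

localRecurrence⇒3-adjacent-gray-code : ∀ {st n} → 1 ≤ n → LocalRecurrence st n →
                                       IsAdjacentGrayCode 3 (IsRGS st n)
localRecurrence⇒3-adjacent-gray-code 1≤n R s t consecutive@(s-valid , t-valid , _) =
  shape⇒3-adjacent R s-valid t-valid (consecutive⇒shape 1≤n consecutive)

maxSt-take-suc : ∀ x i → maxSt (take (suc i) x) ≡ maxSt (take i x) ⊔ at x i
maxSt-take-suc [] zero = refl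
maxSt-take-suc [] (suc i) = refl
maxSt-take-suc (y ∷ ys) zero = ⊔-identityʳ y
maxSt-take-suc (y ∷ ys) (suc i) =
  trans (cong (y ⊔_) (maxSt-take-suc ys i)) (sym (⊔-assoc y (maxSt (take i ys)) (at ys i)))

maxSt-localRecurrence : ∀ n → LocalRecurrence maxSt n
maxSt-localRecurrence n = record
  { next = λ a _ c → a ⊔ c
  ; st-take-suc = λ x i _ _ → maxSt-take-suc x i
  ; next-suc = λ a _ c → ≤-trans (⊔-monoʳ-≤ a (n≤1+n c)) (n≤1+n _) , ⊔-monoˡ-≤ (suc c) (n≤1+n a)
  ; st-take-suc-new-max = λ x j _ _ _ new-max →
      trans (maxSt-take-suc x j) (trans (cong (maxSt (take j x) ⊔_) new-max)
        (trans (m≤n⇒m⊔n≡n (m≤m+n _ 1)) (sym new-max)))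
  }

lv-take-suc : ∀ x i → i < length x → lv (take (suc i) x) ≡ at x i
lv-take-suc (y ∷ ys) zero _ = refl
lv-take-suc (y ∷ z ∷ ys) (suc i) (s≤s i<len) = lv-take-suc (z ∷ ys) i i<len

lv-localRecurrence : ∀ n → LocalRecurrence lv n
lv-localRecurrence n = record
  { next = λ _ _ c → c
  ; st-take-suc = λ x i _ i<len → lv-take-suc x i i<len
  ; next-suc = λ _ _ c → ≤-trans (n≤1+n c) (n≤1+n _) , ≤-refl
  ; st-take-suc-new-max = λ x j (len , _) _ j<n _ → lv-take-suc x j (subst (j <_) (sym len) j<n)
  }

asc-pair-< : ∀ {l c} → l < c → asc (l ∷ c ∷ []) ≡ 1
asc-pair-< {l} {c} l<c with l <? c
... | yes _ = refl
... | no l≮c = ⊥-elim (l≮c l<c)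

asc-pair-≮ : ∀ {l c} → ¬ l < c → asc (l ∷ c ∷ []) ≡ 0
asc-pair-≮ {l} {c} l≮c with l <? c
... | yes l<c = ⊥-elim (l≮c l<c)
... | no _ = refl

asc-pair-≤1 : ∀ l c → asc (l ∷ c ∷ []) ≤ 1
asc-pair-≤1 l c with l <? c
... | yes _ = ≤-refl
... | no _ = z≤n

ascFrom-take-suc : ∀ h ys i → i < length ys →
                   ascFrom h (take (suc i) ys) ≡ ascFrom h (take i ys) + asc (at (h ∷ ys) i ∷ at ys i ∷ [])
ascFrom-take-suc h (y ∷ ys) zero _ = refl
ascFrom-take-suc h (y ∷ ys) (suc i) (s≤s i<len) with h <? y
... | yes _ = cong suc (ascFrom-take-suc y ys i i<len)
... | no _ = ascFrom-take-suc y ys i i<len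

asc-take-suc : ∀ x i → 1 ≤ i → i < length x →
               asc (take (suc i) x) ≡ asc (take i x) + asc (at x (i ∸ 1) ∷ at x i ∷ [])
asc-take-suc (h ∷ ys) (suc i) _ (s≤s i<len) = ascFrom-take-suc h ys i i<len

at-≤-asc-take : ∀ {n x} → Ascent n x → ∀ i → i < n → at x i ≤ asc (take (suc i) x)
at-≤-asc-take {x = x} (_ , head , _) zero 0<n = subst (_≤ asc (take 1 x)) (sym (head 0<n)) z≤n
at-≤-asc-take {n} {x} x-valid@(len , _ , growth) (suc i) 1+i<n
  with asc-take-suc x (suc i) (s≤s z≤n) (subst (suc i <_) (sym len) 1+i<n) | at x i <? at x (suc i)
... | asc-step | yes ascent = subst (at x (suc i) ≤_)
        (sym (trans asc-step (cong (asc (take (suc i) x) +_) (asc-pair-< ascent))))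
        (growth (suc i) (s≤s z≤n) 1+i<n)
... | asc-step | no no-ascent = subst (at x (suc i) ≤_)
        (sym (trans asc-step (trans (cong (asc (take (suc i) x) +_) (asc-pair-≮ no-ascent)) (+-identityʳ _))))
        (≤-trans (≮⇒≥ no-ascent) (at-≤-asc-take x-valid i (<-trans (n<1+n i) 1+i<n)))

asc-localRecurrence : ∀ n → LocalRecurrence asc n
asc-localRecurrence n = record
  { next = λ a l c → a + asc (l ∷ c ∷ [])
  ; st-take-suc = asc-take-suc
  ; next-suc = λ a l c → +-≤-suc-+ a l c (suc c) , +-≤-suc-+ a l (suc c) c
  ; st-take-suc-new-max = new-max
  }
  where
  +-≤-suc-+ : ∀ a l c c′ → a + asc (l ∷ c ∷ []) ≤ suc (a + asc (l ∷ c′ ∷ []))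
  +-≤-suc-+ a l c c′ = ≤-trans (+-monoʳ-≤ a (asc-pair-≤1 l c))
                         (subst (_≤ suc (a + asc (l ∷ c′ ∷ []))) (+-comm 1 a) (s≤s (m≤m+n a _)))

  new-max : ∀ x j → Ascent n x → 1 ≤ j → j < n → at x j ≡ asc (take j x) + 1 →
            asc (take (suc j) x) ≡ at x j
  new-max x (suc i) x-valid@(len , _ , _) _ 1+i<n new =
    trans (asc-take-suc x (suc i) (s≤s z≤n) (subst (suc i <_) (sym len) 1+i<n))
          (trans (cong (asc (take (suc i) x) +_) (asc-pair-< ascent)) (sym new))
    where
    ascent : at x i < at x (suc i)
    ascent = subst (at x i <_) (trans (+-comm 1 _) (sym new))
                   (s≤s (at-≤-asc-take x-valid i (<-trans (n<1+n i) 1+i<n)))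

theorem1 : (n : ℕ) → 1 ≤ n →
    IsAdjacentGrayCode 3 (Ascent n) × IsAdjacentGrayCode 3 (Restricted n) × IsAdjacentGrayCode 3 (Staircase n)
theorem1 n 1≤n =
  localRecurrence⇒3-adjacent-gray-code 1≤n (asc-localRecurrence n) ,
  localRecurrence⇒3-adjacent-gray-code 1≤n (maxSt-localRecurrence n) ,
  localRecurrence⇒3-adjacent-gray-code 1≤n (lv-localRecurrence n)
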